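{- Let $M$ be a matroid on a finite set $E$ with $r(M)>0$. If $M$ is a unique expansion matroid, then $M$ is a unique exchange matroid.
   Context: $\mathcal{B}(M)$ is the family of bases, $r(M)$ the common cardinality of bases. $s(M)=\{A \text{ independent}: |A|=r(M)-1\}$. $M$ is a unique expansion matroid if for every $B\in\mathcal{B}(M)$ and every $A\in s(M)$, whenever $e_1,e_2\in B$ satisfy $A\cup\{e_1\},A\cup\{e_2\}\in\mathcal{B}(M)$, then $e_1=e_2$. $M$ is a unique exchange matroid if for all $B_1,B_2\in\mathcal{B}(M)$, whenever $x\in B_1-B_2$, $y_1,y_2\in B_2-B_1$, $(B_1-\{x\})\cup\{y_1\}\in\mathcal{B}(M)$ and $(B_1-\{x\})\cup\{y_2\}\in\mathcal{B}(M)$, then $y_1=y_2$. -}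

module Defs where

open import Level using (Level; suc; _⊔_)
open import Data.Nat using (ℕ; _<_; _+_) renaming (suc to 1+)
open import Data.Fin using (Fin)
open import Data.Fin.Subset using (Subset; ⊥; ⁅_⁆; _∈_; _∉_; _⊆_; _∪_; _-_; ∣_∣)
open import Data.Product using (Σ; _×_; ∃; ∃-syntax)
open import Relation.Binary.PropositionalEquality using (_≡_)
open import Relation.Nullary using (¬_)

record Matroid (n : ℕ) : Set₁ where
  field
    Indep      : Subset n → Set
    indep-∅    : Indep ⊥
    indep-⊆    : ∀ {A B} → A ⊆ B → Indep B → Indep A
    indep-aug  : ∀ {A B} → Indep A → Indep B → ∣ A ∣ < ∣ B ∣ →
                 ∃[ x ] (x ∈ B × x ∉ A × Indep (A ∪ ⁅ x ⁆))

module _ {n : ℕ} (M : Matroid n) where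
  open Matroid M

  IsBasis : Subset n → Set
  IsBasis B = Indep B × (∀ x → x ∉ B → ¬ Indep (B ∪ ⁅ x ⁆))

  -- r(M) = k : k is the (common) cardinality of the bases.
  HasRank : ℕ → Set
  HasRank k = ∃[ B ] (IsBasis B × ∣ B ∣ ≡ k)

  InS : Subset n → Set
  InS A = Indep A × HasRank (1+ ∣ A ∣)

  UniqueExpansion : Set
  UniqueExpansion =
    ∀ B A e₁ e₂ → IsBasis B → InS A → e₁ ∈ B → e₂ ∈ B →
    IsBasis (A ∪ ⁅ e₁ ⁆) → IsBasis (A ∪ ⁅ e₂ ⁆) → e₁ ≡ e₂

  UniqueExchange : Set
  UniqueExchange =
    ∀ B₁ B₂ x y₁ y₂ → IsBasis B₁ → IsBasis B₂ →
    x ∈ B₁ → x ∉ B₂ → y₁ ∈ B₂ → y₁ ∉ B₁ → y₂ ∈ B₂ → y₂ ∉ B₁ →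
    IsBasis ((B₁ - x) ∪ ⁅ y₁ ⁆) → IsBasis ((B₁ - x) ∪ ⁅ y₂ ⁆) → y₁ ≡ y₂

-- Removing x from a basis B₁ leaves an independent set A = B₁ - x of size
-- r(M) - 1, so A ∈ s(M).  Two exchanges (B₁ - x) ∪ {y₁} and (B₁ - x) ∪ {y₂}
-- with y₁, y₂ ∈ B₂ are then two expansions of A by elements of the basis B₂,
-- and unique expansion forces y₁ = y₂.
module Submission where

open import Defs
open import Data.Nat using (ℕ; _<_; suc)
open import Data.Fin using (Fin)
open import Data.Fin.Subset using (Subset; inside; outside; _∈_; _-_; ∣_∣)
open import Data.Fin.Subset.Properties using (p─⊥≡p; p─q⊆p)
open import Data.Vec using (_∷_; here; there)
open import Data.Product using (_,_; proj₁)
open import Relation.Binary.PropositionalEquality using (_≡_; cong; sym)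

∣p∣≡1+∣p-x∣ : ∀ {n} (p : Subset n) {x : Fin n} → x ∈ p → ∣ p ∣ ≡ suc ∣ p - x ∣
∣p∣≡1+∣p-x∣ (inside  ∷ p) here        = cong (λ q → suc ∣ q ∣) (sym (p─⊥≡p p))
∣p∣≡1+∣p-x∣ (inside  ∷ p) (there x∈p) = cong suc (∣p∣≡1+∣p-x∣ p x∈p)
∣p∣≡1+∣p-x∣ (outside ∷ p) (there x∈p) = ∣p∣≡1+∣p-x∣ p x∈p

module _ {n : ℕ} (M : Matroid n) where
  open Matroid M

  basis-minus-element∈s : ∀ {B x} → IsBasis M B → x ∈ B → InS M (B - x)
  basis-minus-element∈s {B} B-basis x∈B =
    indep-⊆ (p─q⊆p B _) (proj₁ B-basis) , B , B-basis , ∣p∣≡1+∣p-x∣ B x∈B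

  uniqueExpansion⇒uniqueExchange : UniqueExpansion M → UniqueExchange M
  uniqueExpansion⇒uniqueExchange unique B₁ B₂ x y₁ y₂ B₁-basis B₂-basis x∈B₁ _
                                 y₁∈B₂ _ y₂∈B₂ _ =
    unique B₂ (B₁ - x) y₁ y₂ B₂-basis (basis-minus-element∈s B₁-basis x∈B₁)
           y₁∈B₂ y₂∈B₂

proposition18 : (n : ℕ) (M : Matroid n) (r : ℕ) → HasRank M r → 0 < r →
    UniqueExpansion M → UniqueExchange M
proposition18 n M _ _ _ = uniqueExpansion⇒uniqueExchange M
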